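{- If $r$ is a balanced rotor type, then $|UU(r)|\le |r|$, $|UD(r)|\le |r|$, $|DU(r)|\le |r|$, and $|DD(r)|\le |r|$.
   Context: A rotor type is an infinite periodic sequence $r=(r^{(1)},r^{(2)},\dots)$ of natural numbers (states), with (fundamental) period $|r|$. A two-state rotor type is written over the states $\{1,2\}$ with the convention $r^{(1)}=1$; it is balanced if its two states occur equally often in a period. A rotor-router network: a finite digraph, a source vertex, target vertices of outdegree $0$, and at each non-target vertex $v$ a periodic sequence $e_v^{(1)},e_v^{(2)},\dots$ of out-edges; a particle starts at the source, on its $n$-th visit to a non-target vertex $v$ leaves along $e_v^{(n)}$, and whenever it reaches a target it is returned to the source; the hitting sequence is the (periodic) sequence of targets reached. The compressor network for $r$ has non-target vertices $1$ (source), $2,3$ and targets $4,5$. On the $n$-th departure: from vertex $1$ the particle goes to vertex $2$ if $r^{(n)}=1$ and to vertex $3$ if $r^{(n)}=2$; from vertex $2$, in variant $U$ it goes to vertex $1$ if $r^{(n)}=1$ and to target $4$ if $r^{(n)}=2$, in variant $D$ to target $4$ if $r^{(n)}=1$ and to vertex $1$ if $r^{(n)}=2$; from vertex $3$ likewise with target $5$. For $X,Y\in\{U,D\}$, $XY(r)$ is the hitting sequence with variant $X$ at vertex $2$ and $Y$ at vertex $3$ (with $4$ written as $1$ and $5$ as $2$), and $|XY(r)|$ is its period. -}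

module Defs where

open import Data.Nat using (ℕ; zero; suc; _+_; _<_; _≤_)
open import Data.Product using (_×_; _,_; proj₁; proj₂; ∃)
open import Data.Maybe using (Maybe; just; nothing)
open import Relation.Binary.PropositionalEquality using (_≡_; _≢_)
open import Relation.Nullary using (¬_)

-- Sequences are 0-indexed: the paper's r^(n) is  r (n - 1).

IsPeriod : {A : Set} → (ℕ → A) → ℕ → Set
IsPeriod s p = ∀ n → s (n + p) ≡ s n

FundamentalPeriod : {A : Set} → (ℕ → A) → ℕ → Set
FundamentalPeriod s p =
  (0 < p) × IsPeriod s p × (∀ q → 0 < q → q < p → ¬ IsPeriod s q)

data State : Set where
  one two : State

count : State → (ℕ → State) → ℕ → ℕ
count x r zero = 0
count x r (suc n) with r n
... | one with x
...   | one = suc (count x r n)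
...   | two = count x r n
count x r (suc n) | two with x
...   | one = count x r n
...   | two = suc (count x r n)

Balanced : (ℕ → State) → ℕ → Set
Balanced r p = count one r p ≡ count two r p

data Vertex : Set where
  v1 v2 v3 : Vertex

data Variant : Set where
  U D : Variant

-- Configuration: current position (a non-target vertex) and, for each
-- non-target vertex, the number of departures from it so far.
record Config : Set where
  constructor cfg
  field
    pos : Vertex
    cnt : Vertex → ℕ
open Config public

-- Where a particle goes: either to a non-target vertex or to a target
-- (target 4 written as one, target 5 as two).
data Dest : Set where
  toV : Vertex → Dest
  toT : State → Dest

-- Destination from vertex 2 (resp. 3) with the given variant, whose
-- target is t, when the current rotor state is s.
outOf : Variant → State → State → Dest
outOf U t one = toV v1
outOf U t two = toT t
outOf D t one = toT t
outOf D t two = toV v1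

dest : Variant → Variant → Vertex → State → Dest
dest X Y v1 one = toV v2
dest X Y v1 two = toV v3
dest X Y v2 s   = outOf X one s
dest X Y v3 s   = outOf Y two s

bump : Vertex → (Vertex → ℕ) → Vertex → ℕ
bump v1 c v1 = suc (c v1)
bump v2 c v2 = suc (c v2)
bump v3 c v3 = suc (c v3)
bump v1 c v2 = c v2
bump v1 c v3 = c v3
bump v2 c v1 = c v1
bump v2 c v3 = c v3
bump v3 c v1 = c v1
bump v3 c v2 = c v2

-- One departure: the n-th departure (n = cnt v + 1) from v uses r^(n),
-- i.e. r (cnt v).  A particle reaching a target is returned to the
-- source v1, and the hit target is recorded.
step : Variant → Variant → (ℕ → State) → Config → Config × Maybe State
step X Y r (cfg v c) with dest X Y v (r (c v))
... | toV w = cfg w (bump v c) , nothing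
... | toT t = cfg v1 (bump v c) , just t

walk : Variant → Variant → (ℕ → State) → ℕ → Config
walk X Y r zero    = cfg v1 (λ _ → 0)
walk X Y r (suc t) = proj₁ (step X Y r (walk X Y r t))

hitAt : Variant → Variant → (ℕ → State) → ℕ → Maybe State
hitAt X Y r t = proj₂ (step X Y r (walk X Y r t))

StrictlyIncreasing : (ℕ → ℕ) → Set
StrictlyIncreasing τ = ∀ k → τ k < τ (suc k)

-- h is the hitting sequence XY(r): h k is the target of the (k+1)-th hit,
-- where τ enumerates, in increasing order, exactly the departures that hit.
IsHittingSequence : Variant → Variant → (ℕ → State) → (ℕ → State) → Set
IsHittingSequence X Y r h =
  ∃ λ (τ : ℕ → ℕ) →
    StrictlyIncreasing τ
    × (∀ k → hitAt X Y r (τ k) ≡ just (h k))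
    × (∀ t → hitAt X Y r t ≢ nothing → ∃ λ k → τ k ≡ t)

-- After every two departures the particle is back at the source: in round k it walks to the
-- sink of state r^(k+1), which has been left as often as that state occurs among
-- r^(1), ..., r^(k), and it may hit a target on the way back.  Balance makes each state
-- occur exactly p times in 2p rounds, so the sequence of rounds is 2p-periodic, and in one
-- such period each sink is left p times, of which half (again by balance) reach its target.
-- Hence the departures are 4p-periodic with exactly p hits per period, and the hitting
-- sequence inherits the period p.
module Submission where

open import Data.Maybe using (Maybe; just; nothing)
open import Data.Nat
open import Data.Nat.DivMod using (_%_; _/_; m%n<n; m≡m%n+[m/n]*n)
open import Data.Nat.Induction using (<-rec)
open import Data.Nat.Properties
open import Algebra.Properties.CommutativeSemigroup +-commutativeSemigroup using (x∙yz≈y∙xz; xy∙z≈xz∙y)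
open import Data.Product using (_×_; _,_; proj₁; proj₂; ∃)
open import Data.Sum using (_⊎_; inj₁; inj₂)
open import Function using (_∘_)
open import Relation.Binary.Definitions using (DecidableEquality)
open import Relation.Binary.PropositionalEquality
open import Relation.Nullary using (¬_; Dec; yes; no; contradiction)
open import Relation.Nullary.Decidable using (map′; _×-dec_)
open import Relation.Unary using (Decidable)
open import Defs

open ≡-Reasoning

-- Periodic sequences

module _ {A : Set} {s : ℕ → A} where

  isPeriod-+ : ∀ {p q} → IsPeriod s p → IsPeriod s q → IsPeriod s (p + q)
  isPeriod-+ {p} {q} p-period q-period n = begin
    s (n + (p + q)) ≡⟨ cong s (+-assoc n p q) ⟨
    s (n + p + q)   ≡⟨ q-period (n + p) ⟩
    s (n + p)       ≡⟨ p-period n ⟩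
    s n             ∎

  isPeriod-* : ∀ {p} → IsPeriod s p → ∀ m → IsPeriod s (m * p)
  isPeriod-* p-period zero    n = cong s (+-identityʳ n)
  isPeriod-* p-period (suc m)   = isPeriod-+ p-period (isPeriod-* p-period m)

  isPeriod-fromPrefix : ∀ {N q} → 0 < N → IsPeriod s N →
                        (∀ {n} → n < N → s (n + q) ≡ s n) → IsPeriod s q
  isPeriod-fromPrefix {N} {q} N>0 N-period prefix n = begin
    s (n + q)         ≡⟨ cong (λ m → s (m + q)) n≡i+j*N ⟩
    s (i + j * N + q) ≡⟨ cong s (xy∙z≈xz∙y i (j * N) q) ⟩
    s (i + q + j * N) ≡⟨ isPeriod-* N-period j (i + q) ⟩
    s (i + q)         ≡⟨ prefix (m%n<n n N) ⟩
    s i               ≡⟨ isPeriod-* N-period j i ⟨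
    s (i + j * N)     ≡⟨ cong s n≡i+j*N ⟨
    s n               ∎
    where
    instance _ = >-nonZero N>0
    i = n % N
    j = n / N
    n≡i+j*N : n ≡ i + j * N
    n≡i+j*N = m≡m%n+[m/n]*n n N

least : {P : ℕ → Set} → Decidable P → ∀ {n} → P n →
        ∃ λ m → m ≤ n × P m × (∀ {k} → k < m → ¬ P k)
least {P} P? {n} = <-rec Least search n
  where
  Least : ℕ → Set
  Least n = P n → ∃ λ m → m ≤ n × P m × (∀ {k} → k < m → ¬ P k)

  search : ∀ n → (∀ {k} → k < n → Least k) → Least n
  search n below Pn with anyUpTo? P? n
  ... | no none = n , ≤-refl , Pn , λ k<n Pk → none (_ , k<n , Pk)
  ... | yes (k , k<n , Pk) with below k<n Pk
  ...   | m , m≤k , Pm , minimal = m , ≤-trans m≤k (<⇒≤ k<n) , Pm , minimal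

module _ {A : Set} (_≟_ : DecidableEquality A) {s : ℕ → A} {N : ℕ}
         (N>0 : 0 < N) (N-period : IsPeriod s N) where

  isPeriod? : ∀ q → Dec (IsPeriod s q)
  isPeriod? q = map′ (isPeriod-fromPrefix N>0 N-period) (λ q-period {n} _ → q-period n)
                     (allUpTo? (λ n → s (n + q) ≟ s n) N)

  fundamentalPeriod-≤ : ∃ λ q → FundamentalPeriod s q × q ≤ N
  fundamentalPeriod-≤ with least (λ q → (0 <? q) ×-dec isPeriod? q) (N>0 , N-period)
  ... | q , q≤N , (q>0 , q-period) , minimal =
    q , (q>0 , q-period , λ q′ q′>0 q′<q q′-period → minimal q′<q (q′>0 , q′-period)) , q≤N

-- Counting and enumerating the hits of a partial sequence

weight : {A : Set} → Maybe A → ℕ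
weight (just _) = 1
weight nothing  = 0

weight≤1 : {A : Set} (m : Maybe A) → weight m ≤ 1
weight≤1 (just _) = ≤-refl
weight≤1 nothing  = z≤n

weight-≢nothing : {A : Set} {m : Maybe A} → m ≢ nothing → weight m ≡ 1
weight-≢nothing {m = just _}  _          = refl
weight-≢nothing {m = nothing} m≢nothing = contradiction refl m≢nothing

fromJust : {A : Set} (m : Maybe A) → .(weight m ≡ 1) → A
fromJust (just a) _ = a
fromJust nothing  ()

just-fromJust : {A : Set} (m : Maybe A) .(w : weight m ≡ 1) → m ≡ just (fromJust m w)
just-fromJust (just a) _ = refl

fromJust-cong : {A : Set} {m m′ : Maybe A} .{w : weight m ≡ 1} .{w′ : weight m′ ≡ 1} →
                m ≡ m′ → fromJust m w ≡ fromJust m′ w′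
fromJust-cong refl = refl

hits : {A : Set} → (ℕ → Maybe A) → ℕ → ℕ
hits G zero    = 0
hits G (suc t) = weight (G t) + hits G t

HitTime : {A : Set} → (ℕ → Maybe A) → ℕ → ℕ → Set
HitTime G k t = hits G t ≡ k × hits G (suc t) ≡ suc k

Enumerates : {A : Set} → (ℕ → Maybe A) → (ℕ → A) → Set
Enumerates G h =
  ∃ λ (τ : ℕ → ℕ) →
    StrictlyIncreasing τ
    × (∀ k → G (τ k) ≡ just (h k))
    × (∀ t → G t ≢ nothing → ∃ λ k → τ k ≡ t)

module _ {A : Set} (G : ℕ → Maybe A) where

  hits-suc-≤ : ∀ t → hits G (suc t) ≤ suc (hits G t)
  hits-suc-≤ t = +-monoˡ-≤ (hits G t) (weight≤1 (G t))

  hits-monotone : ∀ {t u} → t ≤ u → hits G t ≤ hits G u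
  hits-monotone {u = zero} z≤n = ≤-refl
  hits-monotone {t} {suc u} t≤1+u with m≤n⇒m<n∨m≡n t≤1+u
  ... | inj₁ (s≤s t≤u) = ≤-trans (hits-monotone t≤u) (m≤n+m (hits G u) (weight (G u)))
  ... | inj₂ refl      = ≤-refl

  hitTime-exists : ∀ {k} B → k < hits G B → ∃ (HitTime G k)
  hitTime-exists {k} (suc B) k<hits with k <? hits G B
  ... | yes k<hits′ = hitTime-exists B k<hits′
  ... | no  k≮hits′ = B , hits≡k , ≤-antisym (≤-trans (hits-suc-≤ B) (s≤s (≤-reflexive hits≡k))) k<hits
    where
    hits≡k : hits G B ≡ k
    hits≡k = ≤-antisym (≮⇒≥ k≮hits′) (s≤s⁻¹ (≤-trans k<hits (hits-suc-≤ B)))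

  hitTime-≤ : ∀ {k t u} → HitTime G k t → HitTime G k u → t ≤ u
  hitTime-≤ {k} (ht , _) (_ , hsu) =
    ≮⇒≥ λ u<t → n≮n k (subst₂ _≤_ hsu ht (hits-monotone u<t))

  hitTime-unique : ∀ {k t u} → HitTime G k t → HitTime G k u → t ≡ u
  hitTime-unique ht hu = ≤-antisym (hitTime-≤ ht hu) (hitTime-≤ hu ht)

  hitTime-weight : ∀ {k t} → HitTime G k t → weight (G t) ≡ 1
  hitTime-weight {k} {t} (ht , hst) =
    +-cancelʳ-≡ k (weight (G t)) 1 (trans (cong (weight (G t) +_) (sym ht)) hst)

  weight⇒hitTime : ∀ {t} → weight (G t) ≡ 1 → HitTime G (hits G t) t
  weight⇒hitTime {t} w = refl , cong (_+ hits G t) w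

module _ {A : Set} {G : ℕ → Maybe A} {P N : ℕ} (P-period : IsPeriod G P) (hits-P : hits G P ≡ N) where

  hits-+-period : ∀ t → hits G (t + P) ≡ hits G t + N
  hits-+-period zero    = hits-P
  hits-+-period (suc t) = begin
    weight (G (t + P)) + hits G (t + P) ≡⟨ cong₂ _+_ (cong weight (P-period t)) (hits-+-period t) ⟩
    weight (G t) + (hits G t + N)       ≡⟨ +-assoc (weight (G t)) (hits G t) N ⟨
    weight (G t) + hits G t + N         ∎

  hitTime-+-period : ∀ {k t} → HitTime G k t → HitTime G (k + N) (t + P)
  hitTime-+-period {t = t} (ht , hst) =
    trans (hits-+-period t) (cong (_+ N) ht) , trans (hits-+-period (suc t)) (cong (_+ N) hst)

  hits-*-period : 0 < N → ∀ m → m ≤ hits G (m * P)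
  hits-*-period N>0 zero    = z≤n
  hits-*-period N>0 (suc m) = ≤-trans (+-mono-≤ N>0 (hits-*-period N>0 m)) (≤-reflexive (begin
    N + hits G (m * P) ≡⟨ +-comm N (hits G (m * P)) ⟩
    hits G (m * P) + N ≡⟨ hits-+-period (m * P) ⟨
    hits G (m * P + P) ≡⟨ cong (hits G) (+-comm (m * P) P) ⟩
    hits G (suc m * P) ∎))

  periodic-enumeration : 0 < N → ∃ λ h → Enumerates G h × IsPeriod h N
  periodic-enumeration N>0 =
    h , (τ , τ-increasing , (λ k → just-fromJust (G (τ k)) _) , τ-covers) , h-periodic
    where
    hitTime : ∀ k → ∃ (HitTime G k)
    hitTime k = hitTime-exists G (suc k * P) (hits-*-period N>0 (suc k))

    τ : ℕ → ℕ
    τ = proj₁ ∘ hitTime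

    τ-hitTime : ∀ k → HitTime G k (τ k)
    τ-hitTime = proj₂ ∘ hitTime

    h : ℕ → A
    h k = fromJust (G (τ k)) (hitTime-weight G (τ-hitTime k))

    τ-increasing : StrictlyIncreasing τ
    τ-increasing k = ≰⇒> λ τ[1+k]≤τk →
      n≮n k (subst₂ _≤_ (proj₁ (τ-hitTime (suc k))) (proj₁ (τ-hitTime k)) (hits-monotone G τ[1+k]≤τk))

    τ-covers : ∀ t → G t ≢ nothing → ∃ λ k → τ k ≡ t
    τ-covers t Gt≢nothing =
      hits G t , hitTime-unique G (τ-hitTime (hits G t)) (weight⇒hitTime G (weight-≢nothing Gt≢nothing))

    τ-+-period : ∀ k → τ (k + N) ≡ τ k + P
    τ-+-period k = hitTime-unique G (τ-hitTime (k + N)) (hitTime-+-period (τ-hitTime k))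

    h-periodic : IsPeriod h N
    h-periodic k = fromJust-cong (trans (cong G (τ-+-period k)) (P-period (τ k)))

-- Counting states of a rotor type

_≟ˢ_ : DecidableEquality State
one ≟ˢ one = yes refl
one ≟ˢ two = no λ ()
two ≟ˢ one = no λ ()
two ≟ˢ two = yes refl

indicator : State → State → ℕ
indicator one one = 1
indicator one two = 0
indicator two one = 0
indicator two two = 1

count-suc : ∀ x r n → count x r (suc n) ≡ indicator x (r n) + count x r n
count-suc x r n with r n
count-suc one r n | one = refl
count-suc two r n | one = refl
count-suc one r n | two = refl
count-suc two r n | two = refl

count-one+two : ∀ r n → count one r n + count two r n ≡ n
count-one+two r zero = refl
count-one+two r (suc n) with r n
... | one = cong suc (count-one+two r n)
... | two = trans (+-suc (count one r n) (count two r n)) (cong suc (count-one+two r n))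

count-+-period : ∀ {r p} → IsPeriod r p → ∀ x n → count x r (n + p) ≡ count x r n + count x r p
count-+-period         p-period x zero    = refl
count-+-period {r} {p} p-period x (suc n) = begin
  count x r (suc (n + p))
    ≡⟨ count-suc x r (n + p) ⟩
  indicator x (r (n + p)) + count x r (n + p)
    ≡⟨ cong₂ _+_ (cong (indicator x) (p-period n)) (count-+-period p-period x n) ⟩
  indicator x (r n) + (count x r n + count x r p)
    ≡⟨ +-assoc (indicator x (r n)) (count x r n) (count x r p) ⟨
  indicator x (r n) + count x r n + count x r p
    ≡⟨ cong (_+ count x r p) (count-suc x r n) ⟨
  count x r (suc n) + count x r p ∎

module _ {r : ℕ → State} {p : ℕ} (balanced : Balanced r p) where

  balanced-count : ∀ x → count x r p ≡ count one r p
  balanced-count one = refl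
  balanced-count two = sym balanced

  balanced-count-+ : ∀ x y → count x r p + count y r p ≡ p
  balanced-count-+ x y = begin
    count x r p + count y r p     ≡⟨ cong₂ _+_ (balanced-count x) (balanced-count y) ⟩
    count one r p + count one r p ≡⟨ cong (count one r p +_) balanced ⟩
    count one r p + count two r p ≡⟨ count-one+two r p ⟩
    p                             ∎

  module _ (p-period : IsPeriod r p) where

    count-double-period : ∀ x → count x r (p + p) ≡ p
    count-double-period x = trans (count-+-period p-period x p) (balanced-count-+ x x)

    count-+-double-period : ∀ x n → count x r (n + (p + p)) ≡ count x r n + p
    count-+-double-period x n =
      trans (count-+-period (isPeriod-+ p-period p-period) x n)
            (cong (count x r n +_) (count-double-period x))

-- The compressor network

sink : State → Vertex
sink one = v2
sink two = v3

gate : Variant → Variant → State → Variant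
gate X Y one = X
gate X Y two = Y

landing : Dest → Vertex
landing (toV w) = w
landing (toT _) = v1

hit : Dest → Maybe State
hit (toV _) = nothing
hit (toT t) = just t

exit : Variant → State → State → Maybe State
exit V t σ = hit (outOf V t σ)

-- The rotor state with which a sink of the given variant sends the particle to its target.
firing : Variant → State
firing U = two
firing D = one

landing-outOf : ∀ V t σ → landing (outOf V t σ) ≡ v1
landing-outOf U t one = refl
landing-outOf U t two = refl
landing-outOf D t one = refl
landing-outOf D t two = refl

weight-exit : ∀ V t σ → weight (exit V t σ) ≡ indicator (firing V) σ
weight-exit U t one = refl
weight-exit U t two = refl
weight-exit D t one = refl
weight-exit D t two = refl

bump-source-sink : ∀ c s → bump v1 c (sink s) ≡ c (sink s)
bump-source-sink c one = refl
bump-source-sink c two = refl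

bump-sink-source : ∀ c s → bump (sink s) c v1 ≡ c v1
bump-sink-source c one = refl
bump-sink-source c two = refl

bump-sink-sink : ∀ c s s′ → bump (sink s) c (sink s′) ≡ indicator s′ s + c (sink s′)
bump-sink-sink c one one = refl
bump-sink-sink c one two = refl
bump-sink-sink c two one = refl
bump-sink-sink c two two = refl

AtSource : (ℕ → State) → ℕ → Config → Set
AtSource r k C = pos C ≡ v1 × cnt C v1 ≡ k × (∀ s → cnt C (sink s) ≡ count s r k)

double : ℕ → ℕ
double zero    = zero
double (suc k) = suc (suc (double k))

double-+ : ∀ k q → double (k + q) ≡ double k + double q
double-+ zero    q = refl
double-+ (suc k) q = cong (suc ∘ suc) (double-+ k q)

double-or-suc-double : ∀ t → ∃ λ k → t ≡ double k ⊎ t ≡ suc (double k)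
double-or-suc-double zero = 0 , inj₁ refl
double-or-suc-double (suc t) with double-or-suc-double t
... | k , inj₁ t≡2k   = k , inj₂ (cong suc t≡2k)
... | k , inj₂ t≡2k+1 = suc k , inj₁ (cong suc t≡2k+1)

module _ (X Y : Variant) (r : ℕ → State) where

  -- In round k the particle leaves the sink of r^(k+1) for the (count (r k) r k + 1)-th time.
  roundHit : ℕ → Maybe State
  roundHit k = exit (gate X Y (r k)) (r k) (r (count (r k) r k))

  step-unfold : ∀ v c → let d = dest X Y v (r (c v)) in
                step X Y r (cfg v c) ≡ (cfg (landing d) (bump v c) , hit d)
  step-unfold v c with dest X Y v (r (c v))
  ... | toV w = refl
  ... | toT t = refl

  step-source : ∀ c → step X Y r (cfg v1 c) ≡ (cfg (sink (r (c v1))) (bump v1 c) , nothing)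
  step-source c with r (c v1)
  ... | one = refl
  ... | two = refl

  step-sink : ∀ s c → step X Y r (cfg (sink s) c) ≡
              (cfg v1 (bump (sink s) c) , exit (gate X Y s) s (r (c (sink s))))
  step-sink one c = trans (step-unfold v2 c)
    (cong (λ w → cfg w (bump v2 c) , exit X one (r (c v2))) (landing-outOf X one (r (c v2))))
  step-sink two c = trans (step-unfold v3 c)
    (cong (λ w → cfg w (bump v3 c) , exit Y two (r (c v3))) (landing-outOf Y two (r (c v3))))

  round : ∀ k C → AtSource r k C →
          let C₁ = proj₁ (step X Y r C) in
          proj₂ (step X Y r C) ≡ nothing
          × proj₂ (step X Y r C₁) ≡ roundHit k
          × AtSource r (suc k) (proj₁ (step X Y r C₁))
  round k (cfg v1 c) (refl , c-source , c-sink)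
    rewrite step-source c | c-source | step-sink (r k) (bump v1 c) =
      refl
    , cong (exit (gate X Y (r k)) (r k) ∘ r) (trans (bump-source-sink c (r k)) (c-sink (r k)))
    , refl
    , trans (bump-sink-source (bump v1 c) (r k)) (cong suc c-source)
    , λ s → begin
        bump (sink (r k)) (bump v1 c) (sink s) ≡⟨ bump-sink-sink (bump v1 c) (r k) s ⟩
        indicator s (r k) + bump v1 c (sink s) ≡⟨ cong (indicator s (r k) +_) (bump-source-sink c s) ⟩
        indicator s (r k) + c (sink s)         ≡⟨ cong (indicator s (r k) +_) (c-sink s) ⟩
        indicator s (r k) + count s r k        ≡⟨ count-suc s r k ⟨
        count s r (suc k)                      ∎

  walk-double : ∀ k → AtSource r k (walk X Y r (double k))
  walk-double zero    = refl , refl , λ _ → refl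
  walk-double (suc k) = proj₂ (proj₂ (round k _ (walk-double k)))

  hitAt-double : ∀ k → hitAt X Y r (double k) ≡ nothing
  hitAt-double k = proj₁ (round k _ (walk-double k))

  hitAt-suc-double : ∀ k → hitAt X Y r (suc (double k)) ≡ roundHit k
  hitAt-suc-double k = proj₁ (proj₂ (round k _ (walk-double k)))

  hitAt-periodic : ∀ {q} → IsPeriod roundHit q → IsPeriod (hitAt X Y r) (double q)
  hitAt-periodic {q} q-period t with double-or-suc-double t
  ... | k , inj₁ refl = begin
    hitAt X Y r (double k + double q) ≡⟨ cong (hitAt X Y r) (double-+ k q) ⟨
    hitAt X Y r (double (k + q))      ≡⟨ hitAt-double (k + q) ⟩
    nothing                           ≡⟨ hitAt-double k ⟨
    hitAt X Y r (double k)            ∎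
  ... | k , inj₂ refl = begin
    hitAt X Y r (suc (double k + double q)) ≡⟨ cong (hitAt X Y r ∘ suc) (double-+ k q) ⟨
    hitAt X Y r (suc (double (k + q)))      ≡⟨ hitAt-suc-double (k + q) ⟩
    roundHit (k + q)                        ≡⟨ q-period k ⟩
    roundHit k                              ≡⟨ hitAt-suc-double k ⟨
    hitAt X Y r (suc (double k))            ∎

  hits-hitAt-double : ∀ n → hits (hitAt X Y r) (double n) ≡ hits roundHit n
  hits-hitAt-double zero    = refl
  hits-hitAt-double (suc n) =
    cong₂ _+_ (cong weight (hitAt-suc-double n))
              (cong₂ _+_ (cong weight (hitAt-double n)) (hits-hitAt-double n))

  sinkHits : State → ℕ → ℕ
  sinkHits s = hits (exit (gate X Y s) s ∘ r)

  sinkHits-count : ∀ s m → sinkHits s m ≡ count (firing (gate X Y s)) r m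
  sinkHits-count s zero    = refl
  sinkHits-count s (suc m) =
    trans (cong₂ _+_ (weight-exit (gate X Y s) s (r m)) (sinkHits-count s m))
          (sym (count-suc (firing (gate X Y s)) r m))

  hits-roundHit : ∀ n → hits roundHit n ≡ sinkHits one (count one r n) + sinkHits two (count two r n)
  hits-roundHit zero = refl
  hits-roundHit (suc n) with r n
  ... | one = trans (cong (w +_) (hits-roundHit n)) (sym (+-assoc w (sinkHits one (count one r n)) _))
    where w = weight (exit X one (r (count one r n)))
  ... | two = trans (cong (w +_) (hits-roundHit n)) (x∙yz≈y∙xz w (sinkHits one (count one r n)) _)
    where w = weight (exit Y two (r (count two r n)))

  module _ {p : ℕ} (p-period : IsPeriod r p) (balanced : Balanced r p) where

    roundHit-periodic : IsPeriod roundHit (p + p)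
    roundHit-periodic k rewrite isPeriod-+ p-period p-period k =
      cong (exit (gate X Y (r k)) (r k))
           (trans (cong r (count-+-double-period balanced p-period (r k) k)) (p-period _))

    hits-hitAt-period : hits (hitAt X Y r) (double (p + p)) ≡ p
    hits-hitAt-period = begin
      hits (hitAt X Y r) (double (p + p))
        ≡⟨ hits-hitAt-double (p + p) ⟩
      hits roundHit (p + p)
        ≡⟨ hits-roundHit (p + p) ⟩
      sinkHits one (count one r (p + p)) + sinkHits two (count two r (p + p))
        ≡⟨ cong₂ (λ m n → sinkHits one m + sinkHits two n)
                 (count-double-period balanced p-period one) (count-double-period balanced p-period two) ⟩
      sinkHits one p + sinkHits two p
        ≡⟨ cong₂ _+_ (sinkHits-count one p) (sinkHits-count two p) ⟩
      count (firing X) r p + count (firing Y) r p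
        ≡⟨ balanced-count-+ balanced (firing X) (firing Y) ⟩
      p ∎

theorem5p5 : (r : ℕ → State) (p : ℕ) →
    FundamentalPeriod r p → r 0 ≡ one → Balanced r p →
    (X Y : Variant) →
    ∃ λ (h : ℕ → State) → IsHittingSequence X Y r h
      × ∃ λ (q : ℕ) → FundamentalPeriod h q × q ≤ p
theorem5p5 r p (p>0 , p-period , _) _ balanced X Y
  with periodic-enumeration (hitAt-periodic X Y r (roundHit-periodic X Y r p-period balanced))
                            (hits-hitAt-period X Y r p-period balanced) p>0
... | h , enumerates , h-periodic = h , enumerates , fundamentalPeriod-≤ _≟ˢ_ p>0 h-periodic
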